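{- Let $\alpha\in\mathbb{C}$ and let $S_n(x)\sim\left(\left(\frac{e^t+1}{2}\right)^{\alpha},\frac{t^2}{\log(1+t)}\right)$. Then for $n\geq 1$, \[ S_n(x)=\sum_{l=0}^{n-1}\binom{n-1}{l}N_l^{(n)}E_{n-l}^{(\alpha)}(x). \]
   Context: For formal power series $g(t),f(t)$ over $\mathbb{C}$ with $g$ having nonzero constant term and $f$ having zero constant term and nonzero coefficient of $t$, the Sheffer sequence $S_n(x)\sim(g(t),f(t))$ is the sequence of polynomials defined by $\frac{1}{g(\bar f(t))}e^{y\bar f(t)}=\sum_{k\ge0}S_k(y)\frac{t^k}{k!}$, where $\bar f$ is the compositional inverse of $f$ (equivalently, the unique polynomials with $\langle g(t)f(t)^k\mid S_n(x)\rangle=n!\delta_{n,k}$, where $\langle \sum_k a_k t^k/k!\mid x^n\rangle=a_n$). The Narumi polynomials are defined by $\left(\frac{\log(1+t)}{t}\right)^a(1+t)^x=\sum_{n\ge0}N_n^{(a)}(x)\frac{t^n}{n!}$, and the Narumi numbers are $N_n^{(a)}=N_n^{(a)}(0)$. The Euler polynomials of order $\alpha$ are defined by $\left(\frac{2}{e^t+1}\right)^{\alpha}e^{xt}=\sum_{n\ge0}E_n^{(\alpha)}(x)\frac{t^n}{n!}$. -}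

module Defs where

open import Level using (Level)
open import Data.Nat using (ℕ; zero; suc; _∸_)
open import Data.Nat.Combinatorics using (_C_)
open import Data.Nat using (_!)
open import Algebra.Bundles using (CommutativeRing)

-- Formal power series over a commutative ring R in which every positive
-- integer 1+k has a designated inverse `inv k` (a ℚ-algebra, e.g. ℂ).
-- A series is its coefficient function: a n = [t^n] a.
module PS {c ℓ : Level} (R : CommutativeRing c ℓ)
          (inv : ℕ → CommutativeRing.Carrier R) where
  open CommutativeRing R

  fromℕ : ℕ → Carrier
  fromℕ zero    = 0#
  fromℕ (suc n) = 1# + fromℕ n

  sumTo : ℕ → (ℕ → Carrier) → Carrier
  sumTo zero    f = 0#
  sumTo (suc n) f = sumTo n f + f n

  invFact : ℕ → Carrier
  invFact zero    = 1#
  invFact (suc m) = inv m * invFact m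

  sgn : ℕ → Carrier
  sgn zero    = 1#
  sgn (suc k) = - sgn k

  FPS : Set c
  FPS = ℕ → Carrier

  oneS : FPS
  oneS zero    = 1#
  oneS (suc n) = 0#

  X : FPS
  X zero          = 0#
  X (suc zero)    = 1#
  X (suc (suc n)) = 0#

  addS : FPS → FPS → FPS
  addS a b n = a n + b n

  scale : Carrier → FPS → FPS
  scale r a n = r * a n

  mulS : FPS → FPS → FPS
  mulS a b n = sumTo (suc n) (λ k → a k * b (n ∸ k))

  powS : FPS → ℕ → FPS
  powS a zero    = oneS
  powS a (suc m) = mulS a (powS a m)

  -- composition a(φ(t)), for φ with zero constant term
  compose : FPS → FPS → FPS
  compose a φ n = sumTo (suc n) (λ m → a m * powS φ m n)

  -- exp(a) = ∑_m a^m/m!, for a with zero constant term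
  expS : FPS → FPS
  expS a n = sumTo (suc n) (λ m → invFact m * powS a m n)

  -- log(1+a) = ∑_{m≥1} (-1)^{m+1} a^m/m, for a with zero constant term
  log1p : FPS → FPS
  log1p a n = sumTo n (λ k → sgn k * (inv k * powS a (suc k) n))

  dropConst : FPS → FPS
  dropConst h zero    = 0#
  dropConst h (suc n) = h (suc n)

  -- 1/h = ∑_m (1-h)^m, for h with constant term 1
  recipOne : FPS → FPS
  recipOne h n = sumTo (suc n) (λ m → powS (scale (- 1#) (dropConst h)) m n)

  -- h^β = exp(β log h), for h with constant term 1
  cpow : Carrier → FPS → FPS
  cpow β h = expS (scale β (log1p (dropConst h)))

  expT : FPS
  expT n = invFact n

  expYT : Carrier → FPS
  expYT y = expS (scale y X)

  halfExpPlusOne : FPS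
  halfExpPlusOne = scale (inv 1) (addS expT oneS)

  logOverT : FPS
  logOverT n = log1p X (suc n)

  -- f(t) = t^2 / log(1+t) = t · (log(1+t)/t)^{-1}
  fNar : FPS
  fNar = mulS X (recipOne logOverT)

  egfCoeff : FPS → ℕ → Carrier
  egfCoeff a n = fromℕ (n !) * a n

  narumiPoly : Carrier → Carrier → ℕ → Carrier
  narumiPoly a x = egfCoeff (mulS (cpow a logOverT) (cpow x (addS oneS X)))

  narumiNum : Carrier → ℕ → Carrier
  narumiNum a = narumiPoly a 0#

  eulerPoly : Carrier → Carrier → ℕ → Carrier
  eulerPoly α x = egfCoeff (mulS (cpow α (recipOne halfExpPlusOne)) (expYT x))

  gEuler : Carrier → FPS
  gEuler α = cpow α halfExpPlusOne

  -- Sheffer sequence for (g, f), evaluated at y, given the compositional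
  -- inverse fbar of f:  (1/g(fbar t)) e^{y fbar t} = ∑ S_k(y) t^k/k!
  shefferVal : FPS → FPS → Carrier → ℕ → Carrier
  shefferVal g fbar y =
    egfCoeff (mulS (recipOne (compose g fbar)) (expS (scale y fbar)))

module Submission where

-- Write h = (e^t+1)/2, φ(t) = log(1+t)/t, so that the Sheffer
-- pair is (h^α, f) with f = t/φ, and let E(t) = (2/(e^t+1))^α e^{xt} be the
-- generating function of the Euler polynomials.  Then
--   (1) the Sheffer generating function 1/h^α(f̄) · e^{x f̄} equals E(f̄), because
--       composition with f̄ is a ring map commuting with 1/·, exp and powers;
--   (2) Lagrange inversion gives [t^(m+1)] E(f̄) = 1/(m+1) · [t^m] E′ φ^(m+1);
--   (3) φ^n is the generating function of the Narumi numbers N_l^(n), and the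
--       binomial convolution of E′ with φ^(m+1) yields the stated sum.

open import Defs
open import Level using (Level)
open import Data.Nat using (ℕ; suc; _≤_; _∸_)
open import Data.Nat.Combinatorics using (_C_)
open import Algebra.Bundles using (CommutativeRing)

open import Data.Nat using (zero; _<_; z≤n; s≤s; _!) renaming (_+_ to _+ℕ_; _*_ to _*ℕ_)
open import Data.Nat.Properties
  using (≤-refl; ≤-trans; <⇒≤; m<n⇒m<1+n; m≤n⇒m<n∨m≡n; m∸n≤m; n∸n≡0; m<n⇒0<n∸m;
         m+[n∸m]≡n; m+n∸m≡n; m∸[m∸n]≡n; +-∸-assoc; ∸-+-assoc; +-suc; +-monoʳ-<; _!*_!≢0)
  renaming (+-comm to +ℕ-comm; +-identityʳ to +ℕ-identityʳ)
open import Data.Nat.DivMod using (m/n*n≡m)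
open import Data.Nat.Combinatorics using (nCk≡n!/k![n-k]!; k![n∸k]!∣n!)
open import Data.Sum using (inj₁; inj₂)
open import Data.Product using (_,_)
import Algebra.Properties.CommutativeSemigroup as CommutativeSemigroupProperties
import Algebra.Properties.Group as GroupProperties
import Algebra.Properties.Ring as RingProperties
import Algebra.Solver.Ring.NaturalCoefficients.Default as RingSolver
open import Relation.Binary.Reasoning.MultiSetoid
import Relation.Binary.PropositionalEquality as ≡
open ≡ using (_≡_)

choose-factorials : ∀ {m l} → l ≤ m → (m C l) *ℕ (l ! *ℕ (m ∸ l) !) ≡ m !
choose-factorials {m} {l} l≤m =
  ≡.trans (≡.cong (_*ℕ (l ! *ℕ (m ∸ l) !)) (nCk≡n!/k![n-k]! l≤m))
          (m/n*n≡m {{l !* (m ∸ l) !≢0}} (k![n∸k]!∣n! l≤m))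

<-suc⇒≤ : ∀ {i m} → i < suc m → i ≤ m
<-suc⇒≤ (s≤s i≤m) = i≤m

∸-suc-< : ∀ {n k m} → suc k ≤ n → n ≤ m → n ∸ suc k < m
∸-suc-< {suc n} {k} (s≤s k≤n) n≤m = ≤-trans (s≤s (m∸n≤m n k)) n≤m

Inverts : {c ℓ : Level} (R : CommutativeRing c ℓ) → (ℕ → CommutativeRing.Carrier R) → Set ℓ
Inverts R inv = ∀ k → fromℕ (suc k) * inv k ≈ 1#
  where open CommutativeRing R
        open PS R inv

module FiniteSums {c ℓ : Level} (R : CommutativeRing c ℓ)
                  (inv : ℕ → CommutativeRing.Carrier R) where
  open CommutativeRing R hiding (zero) public
  open PS R inv public
  open GroupProperties +-group using (ε⁻¹≈ε; ⁻¹-involutive; inverseˡ-unique) public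
  open RingSolver commutativeSemiring using (solve; _:+_; _:*_; _:=_) public
  open CommutativeSemigroupProperties +-commutativeSemigroup using () renaming (interchange to +-interchange)

  sum-cong : ∀ n {f g : ℕ → Carrier} → (∀ i → i < n → f i ≈ g i) → sumTo n f ≈ sumTo n g
  sum-cong zero    f≈g = refl
  sum-cong (suc n) f≈g = +-cong (sum-cong n (λ i i<n → f≈g i (m<n⇒m<1+n i<n))) (f≈g n ≤-refl)

  sum-cong′ : ∀ n {f g : ℕ → Carrier} → (∀ i → f i ≈ g i) → sumTo n f ≈ sumTo n g
  sum-cong′ n f≈g = sum-cong n (λ i _ → f≈g i)

  sum-zero : ∀ n {f : ℕ → Carrier} → (∀ i → i < n → f i ≈ 0#) → sumTo n f ≈ 0#
  sum-zero zero    f≈0 = refl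
  sum-zero (suc n) f≈0 =
    trans (+-cong (sum-zero n (λ i i<n → f≈0 i (m<n⇒m<1+n i<n))) (f≈0 n ≤-refl)) (+-identityˡ 0#)

  sum-+ : ∀ n (f g : ℕ → Carrier) → sumTo n (λ i → f i + g i) ≈ sumTo n f + sumTo n g
  sum-+ zero    f g = sym (+-identityˡ 0#)
  sum-+ (suc n) f g = trans (+-congʳ (sum-+ n f g)) (+-interchange _ _ _ _)

  sum-*ˡ : ∀ n a (f : ℕ → Carrier) → a * sumTo n f ≈ sumTo n (λ i → a * f i)
  sum-*ˡ zero    a f = zeroʳ a
  sum-*ˡ (suc n) a f = trans (distribˡ a _ _) (+-congʳ (sum-*ˡ n a f))

  sum-*ʳ : ∀ n a (f : ℕ → Carrier) → sumTo n f * a ≈ sumTo n (λ i → f i * a)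
  sum-*ʳ n a f = trans (*-comm _ a) (trans (sum-*ˡ n a f) (sum-cong′ n (λ i → *-comm a (f i))))

  sum-neg : ∀ n (f : ℕ → Carrier) → - sumTo n f ≈ sumTo n (λ i → - f i)
  sum-neg zero    f = ε⁻¹≈ε
  sum-neg (suc n) f = trans (sym (-‿+-comm _ _)) (+-congʳ (sum-neg n f))
    where open RingProperties ring using (-‿+-comm)

  sum-shift : ∀ n (f : ℕ → Carrier) → sumTo (suc n) f ≈ f 0 + sumTo n (λ i → f (suc i))
  sum-shift zero    f = trans (+-identityˡ _) (sym (+-identityʳ _))
  sum-shift (suc n) f = trans (+-congʳ (sum-shift n f)) (+-assoc _ _ _)

  sum-extend : ∀ {n m} (f : ℕ → Carrier) → n ≤ m → (∀ i → n ≤ i → i < m → f i ≈ 0#) →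
               sumTo m f ≈ sumTo n f
  sum-extend {n} {zero}  f z≤n  f≈0 = refl
  sum-extend {n} {suc m} f n≤1+m f≈0 with m≤n⇒m<n∨m≡n n≤1+m
  ... | inj₂ ≡.refl     = refl
  ... | inj₁ (s≤s n≤m) =
    trans (+-cong (sum-extend f n≤m (λ i n≤i i<m → f≈0 i n≤i (m<n⇒m<1+n i<m))) (f≈0 m n≤m ≤-refl))
          (+-identityʳ _)

  sum-last : ∀ n (f : ℕ → Carrier) → (∀ i → i < n → f i ≈ 0#) → sumTo (suc n) f ≈ f n
  sum-last n f f≈0 = trans (+-congʳ (sum-zero n f≈0)) (+-identityˡ _)

  sum-swap : ∀ n m (F : ℕ → ℕ → Carrier) →
             sumTo n (λ i → sumTo m (F i)) ≈ sumTo m (λ j → sumTo n (λ i → F i j))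
  sum-swap zero    m F = sym (sum-zero m (λ _ _ → refl))
  sum-swap (suc n) m F = trans (+-congʳ (sum-swap n m F)) (sym (sum-+ m _ _))

  sum-reverse : ∀ n (f : ℕ → Carrier) → sumTo (suc n) f ≈ sumTo (suc n) (λ k → f (n ∸ k))
  sum-reverse zero    f = refl
  sum-reverse (suc n) f = begin⟨ setoid ⟩
    sumTo (suc n) f + f (suc n)                    ≈⟨ +-congʳ (sum-reverse n f) ⟩
    sumTo (suc n) (λ k → f (n ∸ k)) + f (suc n)     ≈⟨ +-comm _ _ ⟩
    f (suc n) + sumTo (suc n) (λ k → f (n ∸ k))     ≈⟨ sum-shift (suc n) (λ k → f (suc n ∸ k)) ⟨
    sumTo (suc (suc n)) (λ k → f (suc n ∸ k))       ∎

  sum-triangle : ∀ n (G : ℕ → ℕ → Carrier) →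
    sumTo (suc n) (λ m → sumTo (suc m) (G m))
      ≈ sumTo (suc n) (λ i → sumTo (suc (n ∸ i)) (λ k → G (i +ℕ k) i))
  sum-triangle zero    G = refl
  sum-triangle (suc n) G = begin⟨ setoid ⟩
    sumTo (suc n) (λ m → sumTo (suc m) (G m)) + (sumTo (suc n) (G (suc n)) + G (suc n) (suc n))
      ≈⟨ +-congʳ (sum-triangle n G) ⟩
    Cols n + (sumTo (suc n) (G (suc n)) + G (suc n) (suc n))
      ≈⟨ +-assoc _ _ _ ⟨
    (Cols n + sumTo (suc n) (G (suc n))) + G (suc n) (suc n)
      ≈⟨ +-congʳ (sum-+ (suc n) _ _) ⟨
    sumTo (suc n) (λ i → Col n i + G (suc n) i) + G (suc n) (suc n)
      ≈⟨ +-cong (sum-cong (suc n) (λ i i<1+n → grow i (<-suc⇒≤ i<1+n))) lastColumn ⟩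
    sumTo (suc n) (Col (suc n)) + Col (suc n) (suc n) ∎
    where
    Col : ℕ → ℕ → Carrier
    Col n i = sumTo (suc (n ∸ i)) (λ k → G (i +ℕ k) i)
    Cols : ℕ → Carrier
    Cols n = sumTo (suc n) (Col n)
    grow : ∀ i → i ≤ n → Col n i + G (suc n) i ≈ Col (suc n) i
    grow i i≤n rewrite +-∸-assoc 1 i≤n =
      +-congˡ (reflexive (≡.cong (λ j → G j i)
        (≡.sym (≡.trans (+-suc i (n ∸ i)) (≡.cong suc (m+[n∸m]≡n i≤n))))))
    lastColumn : G (suc n) (suc n) ≈ Col (suc n) (suc n)
    lastColumn rewrite n∸n≡0 n | +ℕ-identityʳ n = sym (+-identityˡ _)

  fromℕ-+ : ∀ m n → fromℕ (m +ℕ n) ≈ fromℕ m + fromℕ n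
  fromℕ-+ zero    n = sym (+-identityˡ _)
  fromℕ-+ (suc m) n = trans (+-congˡ (fromℕ-+ m n)) (sym (+-assoc _ _ _))

  fromℕ-* : ∀ m n → fromℕ (m *ℕ n) ≈ fromℕ m * fromℕ n
  fromℕ-* zero    n = sym (zeroˡ _)
  fromℕ-* (suc m) n = begin⟨ setoid ⟩
    fromℕ (n +ℕ m *ℕ n)                  ≈⟨ fromℕ-+ n (m *ℕ n) ⟩
    fromℕ n + fromℕ (m *ℕ n)             ≈⟨ +-cong (sym (*-identityˡ _)) (fromℕ-* m n) ⟩
    1# * fromℕ n + fromℕ m * fromℕ n     ≈⟨ distribʳ _ _ _ ⟨
    (1# + fromℕ m) * fromℕ n             ∎

module PowerSeries {c ℓ : Level} (R : CommutativeRing c ℓ)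
                   (inv : ℕ → CommutativeRing.Carrier R) where
  open FiniteSums R inv public

  infix 4 _≐_
  _≐_ : FPS → FPS → Set ℓ
  a ≐ b = ∀ n → a n ≈ b n

  ≐-refl : ∀ {a} → a ≐ a
  ≐-refl n = refl

  ≐-sym : ∀ {a b} → a ≐ b → b ≐ a
  ≐-sym a≐b n = sym (a≐b n)

  ≐-trans : ∀ {a b d} → a ≐ b → b ≐ d → a ≐ d
  ≐-trans a≐b b≐d n = trans (a≐b n) (b≐d n)

  zeroS : FPS
  zeroS n = 0#

  negS : FPS → FPS
  negS a n = - a n

  oneS-pos : ∀ m → 0 < m → oneS m ≈ 0#
  oneS-pos (suc m) _ = refl

  -- the ring laws of the Cauchy product, proved coefficientwise; associativity
  -- reorganises the double sum over a triangle
  mulS-cong : ∀ {a a′ b b′} → a ≐ a′ → b ≐ b′ → mulS a b ≐ mulS a′ b′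
  mulS-cong a≐a′ b≐b′ n = sum-cong′ (suc n) (λ i → *-cong (a≐a′ i) (b≐b′ (n ∸ i)))

  -- congruence in one factor; the other factor is passed explicitly, since a
  -- coefficientwise equation does not determine its series by unification
  mulS-congˡ : ∀ {a a′} b → a ≐ a′ → mulS a b ≐ mulS a′ b
  mulS-congˡ b a≐a′ = mulS-cong a≐a′ (≐-refl {b})

  mulS-congʳ : ∀ a {b b′} → b ≐ b′ → mulS a b ≐ mulS a b′
  mulS-congʳ a b≐b′ = mulS-cong (≐-refl {a}) b≐b′

  mulS-comm : ∀ a b → mulS a b ≐ mulS b a
  mulS-comm a b n =
    trans (sum-reverse n (λ k → a k * b (n ∸ k)))
          (sum-cong (suc n) (λ i i<1+n →
            trans (*-comm _ _) (*-congʳ (reflexive (≡.cong b (m∸[m∸n]≡n (<-suc⇒≤ i<1+n)))))))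

  mulS-assoc : ∀ a b d → mulS (mulS a b) d ≐ mulS a (mulS b d)
  mulS-assoc a b d n = begin⟨ setoid ⟩
    sumTo (suc n) (λ m → sumTo (suc m) (λ i → a i * b (m ∸ i)) * d (n ∸ m))
      ≈⟨ sum-cong′ (suc n) (λ m → sum-*ʳ (suc m) _ _) ⟩
    sumTo (suc n) (λ m → sumTo (suc m) (λ i → a i * b (m ∸ i) * d (n ∸ m)))
      ≈⟨ sum-triangle n (λ m i → a i * b (m ∸ i) * d (n ∸ m)) ⟩
    sumTo (suc n) (λ i → sumTo (suc (n ∸ i)) (λ k → a i * b ((i +ℕ k) ∸ i) * d (n ∸ (i +ℕ k))))
      ≈⟨ sum-cong′ (suc n) (λ i → trans (sum-cong′ (suc (n ∸ i)) (λ k → reindex i k))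
                                         (sym (sum-*ˡ (suc (n ∸ i)) _ _))) ⟩
    sumTo (suc n) (λ i → a i * sumTo (suc (n ∸ i)) (λ k → b k * d ((n ∸ i) ∸ k))) ∎
    where
    reindex : ∀ i k → a i * b ((i +ℕ k) ∸ i) * d (n ∸ (i +ℕ k)) ≈ a i * (b k * d ((n ∸ i) ∸ k))
    reindex i k rewrite m+n∸m≡n i k | ≡.sym (∸-+-assoc n i k) = *-assoc _ _ _

  mulS-distribˡ : ∀ a b d → mulS a (addS b d) ≐ addS (mulS a b) (mulS a d)
  mulS-distribˡ a b d n = trans (sum-cong′ (suc n) (λ i → distribˡ _ _ _)) (sum-+ (suc n) _ _)

  mulS-distribʳ : ∀ a b d → mulS (addS b d) a ≐ addS (mulS b a) (mulS d a)
  mulS-distribʳ a b d n = trans (sum-cong′ (suc n) (λ i → distribʳ _ _ _)) (sum-+ (suc n) _ _)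

  mulS-oneʳ : ∀ a → mulS a oneS ≐ a
  mulS-oneʳ a n =
    trans (sum-last n _ (λ i i<n → trans (*-congˡ (oneS-pos _ (m<n⇒0<n∸m i<n))) (zeroʳ _)))
          (trans (*-congˡ (reflexive (≡.cong oneS (n∸n≡0 n)))) (*-identityʳ _))

  mulS-oneˡ : ∀ a → mulS oneS a ≐ a
  mulS-oneˡ a = ≐-trans (mulS-comm oneS a) (mulS-oneʳ a)

  -- Series form a commutative ring under coefficientwise addition and the
  -- Cauchy product; this lets us use the ring solver on series.
  FR : CommutativeRing c ℓ
  FR = record
    { Carrier = FPS ; _≈_ = _≐_ ; _+_ = addS ; _*_ = mulS ; -_ = negS ; 0# = zeroS ; 1# = oneS
    ; isCommutativeRing = record
      { isRing = record
        { +-isAbelianGroup = record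
          { isGroup = record
            { isMonoid = record
              { isSemigroup = record
                { isMagma = record
                  { isEquivalence = record { refl = ≐-refl ; sym = ≐-sym ; trans = ≐-trans }
                  ; ∙-cong = λ a≐a′ b≐b′ n → +-cong (a≐a′ n) (b≐b′ n) }
                ; assoc = λ a b d n → +-assoc _ _ _ }
              ; identity = (λ a n → +-identityˡ _) , (λ a n → +-identityʳ _) }
            ; inverse = (λ a n → -‿inverseˡ _) , (λ a n → -‿inverseʳ _)
            ; ⁻¹-cong = λ a≐b n → -‿cong (a≐b n) }
          ; comm = λ a b n → +-comm _ _ }
        ; *-cong = mulS-cong
        ; *-assoc = mulS-assoc
        ; *-identity = mulS-oneˡ , mulS-oneʳ
        ; distrib = mulS-distribˡ , mulS-distribʳ }
      ; *-comm = mulS-comm } }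

  module F = CommutativeRing FR
  module FP = RingProperties F.ring
  open RingSolver F.commutativeSemiring public
    using () renaming (solve to fsolve; _:+_ to _⊕_; _:*_ to _⊗_; _:=_ to _⊜_)

  scale-cong : ∀ r {a b} → a ≐ b → scale r a ≐ scale r b
  scale-cong r a≐b n = *-congˡ (a≐b n)

  scale-mulˡ : ∀ r a b → mulS (scale r a) b ≐ scale r (mulS a b)
  scale-mulˡ r a b n = trans (sum-cong′ (suc n) (λ i → *-assoc _ _ _)) (sym (sum-*ˡ (suc n) r _))

  scale-mulʳ : ∀ r a b → mulS a (scale r b) ≐ scale r (mulS a b)
  scale-mulʳ r a b =
    ≐-trans (mulS-comm a _) (≐-trans (scale-mulˡ r b a) (scale-cong r (mulS-comm b a)))

  -- a constant series; scaling by r is multiplication by it, which makes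
  -- scaling accessible to the ring solver on series
  const : Carrier → FPS
  const r = scale r oneS

  scale-as-mul : ∀ r a → scale r a ≐ mulS (const r) a
  scale-as-mul r a = ≐-sym (≐-trans (scale-mulˡ r oneS a) (scale-cong r (mulS-oneˡ a)))

  mulX-zero : ∀ a → mulS X a 0 ≈ 0#
  mulX-zero a = trans (+-identityˡ _) (zeroˡ _)

  mulX-suc : ∀ a n → mulS X a (suc n) ≈ a n
  mulX-suc a n = begin⟨ setoid ⟩
    mulS X a (suc n)
      ≈⟨ sum-shift (suc n) _ ⟩
    0# * a (suc n) + sumTo (suc n) (λ i → X (suc i) * a (n ∸ i))
      ≈⟨ +-cong (zeroˡ _) (sum-shift n _) ⟩
    0# + (1# * a n + sumTo n (λ i → 0# * a (n ∸ suc i)))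
      ≈⟨ trans (+-identityˡ _) (+-cong (*-identityˡ _) (sum-zero n (λ i _ → zeroˡ _))) ⟩
    a n + 0#
      ≈⟨ +-identityʳ _ ⟩
    a n ∎

  powS-cong : ∀ {a b} m → a ≐ b → powS a m ≐ powS b m
  powS-cong zero    a≐b = ≐-refl
  powS-cong (suc m) a≐b = mulS-cong a≐b (powS-cong m a≐b)

  powS-order : ∀ a → a 0 ≈ 0# → ∀ m n → n < m → powS a m n ≈ 0#
  powS-order a a0 (suc m) n n<1+m = sum-zero (suc n) term
    where
    term : ∀ i → i < suc n → a i * powS a m (n ∸ i) ≈ 0#
    term zero    _      = trans (*-congʳ a0) (zeroˡ _)
    term (suc k) 1+k<1+n =
      trans (*-congˡ (powS-order a a0 m (n ∸ suc k) (∸-suc-< (<-suc⇒≤ 1+k<1+n) (<-suc⇒≤ n<1+m))))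
            (zeroʳ _)
  powS-const : ∀ a m → a 0 ≈ 1# → powS a m 0 ≈ 1#
  powS-const a zero    a0 = refl
  powS-const a (suc m) a0 = trans (+-identityˡ _) (trans (*-cong a0 (powS-const a m a0)) (*-identityˡ _))

  powS-+ : ∀ a j k → powS a (j +ℕ k) ≐ mulS (powS a j) (powS a k)
  powS-+ a zero    k = ≐-sym (mulS-oneˡ _)
  powS-+ a (suc j) k = ≐-trans (mulS-cong ≐-refl (powS-+ a j k)) (≐-sym (mulS-assoc a (powS a j) (powS a k)))

  powS-mul : ∀ a b m → powS (mulS a b) m ≐ mulS (powS a m) (powS b m)
  powS-mul a b zero    = ≐-sym (mulS-oneˡ _)
  powS-mul a b (suc m) =
    ≐-trans (mulS-cong ≐-refl (powS-mul a b m))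
            (fsolve 4 (λ a b p q → (a ⊗ b) ⊗ (p ⊗ q) ⊜ (a ⊗ p) ⊗ (b ⊗ q)) ≐-refl a b (powS a m) (powS b m))

  powS-one : ∀ m → powS oneS m ≐ oneS
  powS-one zero    = ≐-refl
  powS-one (suc m) = ≐-trans (mulS-cong ≐-refl (powS-one m)) (mulS-oneˡ _)

  powX-shift : ∀ j k d → mulS (powS X j) d (j +ℕ k) ≈ d k
  powX-shift zero    k d = mulS-oneˡ d k
  powX-shift (suc j) k d =
    trans (mulS-assoc X (powS X j) d (suc (j +ℕ k)))
          (trans (mulX-suc (mulS (powS X j) d) (j +ℕ k)) (powX-shift j k d))

  powX-coeff : ∀ j k → powS X j (j +ℕ k) ≈ oneS k
  powX-coeff j k = trans (sym (mulS-oneʳ (powS X j) (j +ℕ k))) (powX-shift j k oneS)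

  compose-cong : ∀ {a a′ φ ψ} → a ≐ a′ → φ ≐ ψ → compose a φ ≐ compose a′ ψ
  compose-cong a≐a′ φ≐ψ n = sum-cong′ (suc n) (λ m → *-cong (a≐a′ m) (powS-cong m φ≐ψ n))

  compose-const : ∀ a φ → compose a φ 0 ≈ a 0
  compose-const a φ = trans (+-identityˡ _) (*-identityʳ _)

  compose-mul-coeff : ∀ φ → φ 0 ≈ 0# → ∀ a d m →
    mulS (compose a φ) d m ≈ sumTo (suc m) (λ j → a j * mulS (powS φ j) d m)
  compose-mul-coeff φ φ0 a d m = begin⟨ setoid ⟩
    sumTo (suc m) (λ k → sumTo (suc k) (λ j → a j * powS φ j k) * d (m ∸ k))
      ≈⟨ sum-cong (suc m) (λ k k<1+m → trans (sum-*ʳ (suc k) _ _) (sym (sum-extend _ (s≤s (<-suc⇒≤ k<1+m))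
            (λ j k<j _ → trans (*-congʳ (trans (*-congˡ (powS-order φ φ0 j k k<j)) (zeroʳ _))) (zeroˡ _))))) ⟩
    sumTo (suc m) (λ k → sumTo (suc m) (λ j → a j * powS φ j k * d (m ∸ k)))
      ≈⟨ sum-swap (suc m) (suc m) _ ⟩
    sumTo (suc m) (λ j → sumTo (suc m) (λ k → a j * powS φ j k * d (m ∸ k)))
      ≈⟨ sum-cong′ (suc m) (λ j → trans (sum-cong′ (suc m) (λ k → *-assoc _ _ _)) (sym (sum-*ˡ (suc m) _ _))) ⟩
    sumTo (suc m) (λ j → a j * mulS (powS φ j) d m) ∎

  compose-add : ∀ a b φ → compose (addS a b) φ ≐ addS (compose a φ) (compose b φ)
  compose-add a b φ n = trans (sum-cong′ (suc n) (λ i → distribʳ _ _ _)) (sum-+ (suc n) _ _)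

  compose-scale : ∀ r a φ → compose (scale r a) φ ≐ scale r (compose a φ)
  compose-scale r a φ n = trans (sum-cong′ (suc n) (λ i → *-assoc _ _ _)) (sym (sum-*ˡ (suc n) r _))

  compose-neg : ∀ a φ → compose (negS a) φ ≐ negS (compose a φ)
  compose-neg a φ n = trans (sum-cong′ (suc n) (λ i → sym (-‿distribˡ-* _ _))) (sym (sum-neg (suc n) _))
    where open RingProperties ring using (-‿distribˡ-*)

  compose-one : ∀ φ → compose oneS φ ≐ oneS
  compose-one φ n =
    trans (sum-shift n _) (trans (+-cong (*-identityˡ _) (sum-zero n (λ i _ → zeroˡ _))) (+-identityʳ _))

  compose-X : ∀ φ → φ 0 ≈ 0# → compose X φ ≐ φ
  compose-X φ φ0 zero    = trans (compose-const X φ) (sym φ0)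
  compose-X φ φ0 (suc n) = begin⟨ setoid ⟩
    compose X φ (suc n)
      ≈⟨ sum-shift (suc n) _ ⟩
    0# * oneS (suc n) + sumTo (suc n) (λ i → X (suc i) * powS φ (suc i) (suc n))
      ≈⟨ +-cong (zeroˡ _) (sum-shift n _) ⟩
    0# + (1# * powS φ 1 (suc n) + sumTo n (λ i → 0# * powS φ (suc (suc i)) (suc n)))
      ≈⟨ trans (+-identityˡ _) (+-cong (*-identityˡ _) (sum-zero n (λ i _ → zeroˡ _))) ⟩
    powS φ 1 (suc n) + 0#
      ≈⟨ trans (+-identityʳ _) (mulS-oneʳ φ (suc n)) ⟩
    φ (suc n) ∎

  compose-mul : ∀ φ → φ 0 ≈ 0# → ∀ a b → compose (mulS a b) φ ≐ mulS (compose a φ) (compose b φ)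
  compose-mul φ φ0 a b n = begin⟨ setoid ⟩
    compose (mulS a b) φ n
      ≈⟨ sum-cong′ (suc n) (λ m → sum-*ʳ (suc m) _ _) ⟩
    sumTo (suc n) (λ m → sumTo (suc m) (λ i → a i * b (m ∸ i) * powS φ m n))
      ≈⟨ sum-triangle n (λ m i → a i * b (m ∸ i) * powS φ m n) ⟩
    sumTo (suc n) (λ j → sumTo (suc (n ∸ j)) (λ k → a j * b ((j +ℕ k) ∸ j) * powS φ (j +ℕ k) n))
      ≈⟨ sum-cong′ (suc n) (λ j → sum-cong′ (suc (n ∸ j)) (λ k → *-congʳ (*-congˡ (reflexive (≡.cong b (m+n∸m≡n j k)))))) ⟩
    sumTo (suc n) (λ j → sumTo (suc (n ∸ j)) (λ k → a j * b k * powS φ (j +ℕ k) n))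
      ≈⟨ sum-cong (suc n) (λ j j<1+n → sum-extend _ (s≤s (m∸n≤m n j))
            (λ k n∸j<k _ → trans (*-congˡ (powS-order φ φ0 _ n (beyond j k (<-suc⇒≤ j<1+n) n∸j<k))) (zeroʳ _))) ⟨
    sumTo (suc n) (λ j → sumTo (suc n) (λ k → a j * b k * powS φ (j +ℕ k) n))
      ≈⟨ sum-cong′ (suc n) (λ j → trans (sum-*ˡ (suc n) _ _) (sum-cong′ (suc n) (λ k →
           trans (sym (*-assoc _ _ _)) (*-congˡ (trans (sym (powS-+ φ k j n))
             (reflexive (≡.cong (λ z → powS φ z n) (+ℕ-comm k j)))))))) ⟨
    sumTo (suc n) (λ j → a j * sumTo (suc n) (λ k → b k * mulS (powS φ k) (powS φ j) n))
      ≈⟨ sum-cong′ (suc n) (λ j → *-congˡ (trans (mulS-comm (powS φ j) (compose b φ) n)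
                                                 (compose-mul-coeff φ φ0 b (powS φ j) n))) ⟨
    sumTo (suc n) (λ j → a j * mulS (powS φ j) (compose b φ) n)
      ≈⟨ compose-mul-coeff φ φ0 a (compose b φ) n ⟨
    mulS (compose a φ) (compose b φ) n ∎
    where
    beyond : ∀ j k → j ≤ n → suc (n ∸ j) ≤ k → n < j +ℕ k
    beyond j k j≤n n∸j<k = ≡.subst (_< j +ℕ k) (m+[n∸m]≡n j≤n) (+-monoʳ-< j n∸j<k)

  compose-pow : ∀ φ → φ 0 ≈ 0# → ∀ a k → compose (powS a k) φ ≐ powS (compose a φ) k
  compose-pow φ φ0 a zero    = compose-one φ
  compose-pow φ φ0 a (suc k) =
    ≐-trans (compose-mul φ φ0 a (powS a k)) (mulS-cong ≐-refl (compose-pow φ φ0 a k))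
module Calculus {c ℓ : Level} (R : CommutativeRing c ℓ) (inv : ℕ → CommutativeRing.Carrier R)
                (inverts : Inverts R inv) where
  open PowerSeries R inv public

  inv-cancel : ∀ k a → inv k * (fromℕ (suc k) * a) ≈ a
  inv-cancel k a = trans (sym (*-assoc _ _ _)) (trans (*-congʳ (trans (*-comm _ _) (inverts k))) (*-identityˡ a))

  D : FPS → FPS
  D a n = fromℕ (suc n) * a (suc n)

  -- a series is determined by its constant term and its derivative
  coeff-from-D : ∀ a n → a (suc n) ≈ inv n * D a n
  coeff-from-D a n = sym (inv-cancel n (a (suc n)))

  D-cong : ∀ {a b} → a ≐ b → D a ≐ D b
  D-cong a≐b n = *-congˡ (a≐b (suc n))

  D-add : ∀ a b → D (addS a b) ≐ addS (D a) (D b)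
  D-add a b n = distribˡ _ _ _

  D-neg : ∀ a → D (negS a) ≐ negS (D a)
  D-neg a n = sym (-‿distribʳ-* _ _)
    where open RingProperties ring using (-‿distribʳ-*)

  D-scale : ∀ r a → D (scale r a) ≐ scale r (D a)
  D-scale r a n = solve 3 (λ f r x → f :* (r :* x) := r :* (f :* x)) refl _ r _

  D-one : D oneS ≐ zeroS
  D-one n = zeroʳ _

  D-X : D X ≐ oneS
  D-X zero    = trans (*-identityʳ _) (+-identityʳ _)
  D-X (suc n) = zeroʳ _

  D-mul : ∀ a b → D (mulS a b) ≐ addS (mulS (D a) b) (mulS a (D b))
  D-mul a b n = begin⟨ setoid ⟩
    fromℕ (suc n) * sumTo (suc (suc n)) (λ k → a k * b (suc n ∸ k))
      ≈⟨ sum-*ˡ (suc (suc n)) _ _ ⟩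
    sumTo (suc (suc n)) (λ k → fromℕ (suc n) * (a k * b (suc n ∸ k)))
      ≈⟨ sum-cong (suc (suc n)) (λ k k<2+n → split k (<-suc⇒≤ k<2+n)) ⟩
    sumTo (suc (suc n)) (λ k → fromℕ k * a k * b (suc n ∸ k) + a k * (fromℕ (suc n ∸ k) * b (suc n ∸ k)))
      ≈⟨ sum-+ (suc (suc n)) _ _ ⟩
    sumTo (suc (suc n)) (λ k → fromℕ k * a k * b (suc n ∸ k))
      + sumTo (suc (suc n)) (λ k → a k * (fromℕ (suc n ∸ k) * b (suc n ∸ k)))
      ≈⟨ +-cong derivedLeft derivedRight ⟩
    mulS (D a) b n + mulS a (D b) n ∎
    where
    -- (1+n) = k + (1+n-k) distributes the weight over the two factors
    split : ∀ k → k ≤ suc n → fromℕ (suc n) * (a k * b (suc n ∸ k))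
                             ≈ fromℕ k * a k * b (suc n ∸ k) + a k * (fromℕ (suc n ∸ k) * b (suc n ∸ k))
    split k k≤1+n =
      trans (*-congʳ (trans (reflexive (≡.cong fromℕ (≡.sym (m+[n∸m]≡n k≤1+n)))) (fromℕ-+ k (suc n ∸ k))))
            (solve 4 (λ p q x y → (p :+ q) :* (x :* y) := p :* x :* y :+ x :* (q :* y)) refl
                   (fromℕ k) (fromℕ (suc n ∸ k)) (a k) (b (suc n ∸ k)))
    derivedLeft : sumTo (suc (suc n)) (λ k → fromℕ k * a k * b (suc n ∸ k)) ≈ mulS (D a) b n
    derivedLeft = trans (sum-shift (suc n) _) (trans (+-congʳ (trans (*-congʳ (zeroˡ _)) (zeroˡ _))) (+-identityˡ _))
    derivedRight : sumTo (suc (suc n)) (λ k → a k * (fromℕ (suc n ∸ k) * b (suc n ∸ k))) ≈ mulS a (D b) n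
    derivedRight = trans (+-cong (sum-cong (suc n) (λ k k<1+n →
                     reflexive (≡.cong (λ z → a k * (fromℕ z * b z)) (+-∸-assoc 1 (<-suc⇒≤ k<1+n)))))
                     lastTerm) (+-identityʳ _)
      where
      lastTerm : a (suc n) * (fromℕ (n ∸ n) * b (n ∸ n)) ≈ 0#
      lastTerm rewrite n∸n≡0 n = trans (*-congˡ (zeroˡ _)) (zeroʳ _)

  D-pow : ∀ a k → D (powS a (suc k)) ≐ scale (fromℕ (suc k)) (mulS (powS a k) (D a))
  D-pow a zero    n = trans (D-cong (mulS-oneʳ a) n)
                            (trans (sym (mulS-oneˡ (D a) n)) (sym (trans (*-congʳ (+-identityʳ _)) (*-identityˡ _))))
  D-pow a (suc k) n = begin⟨ setoid ⟩
    D (mulS a P) n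
      ≈⟨ D-mul a P n ⟩
    mulS (D a) P n + mulS a (D P) n
      ≈⟨ +-cong (mulS-comm (D a) P n) (mulS-cong ≐-refl (D-pow a k) n) ⟩
    mulS P (D a) n + mulS a (scale s (mulS (powS a k) (D a))) n
      ≈⟨ +-congˡ (trans (scale-mulʳ s a (mulS (powS a k) (D a)) n) (*-congˡ (sym (mulS-assoc a (powS a k) (D a) n)))) ⟩
    mulS P (D a) n + s * mulS P (D a) n
      ≈⟨ trans (+-congʳ (sym (*-identityˡ _))) (sym (distribʳ _ _ _)) ⟩
    (1# + s) * mulS P (D a) n ∎
    where
    P = powS a (suc k)
    s = fromℕ (suc k)

  chain-rule : ∀ φ → φ 0 ≈ 0# → ∀ a → D (compose a φ) ≐ mulS (compose (D a) φ) (D φ)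
  chain-rule φ φ0 a n = begin⟨ setoid ⟩
    fromℕ (suc n) * sumTo (suc (suc n)) (λ m → a m * powS φ m (suc n))
      ≈⟨ sum-*ˡ (suc (suc n)) _ _ ⟩
    sumTo (suc (suc n)) (λ m → fromℕ (suc n) * (a m * powS φ m (suc n)))
      ≈⟨ sum-cong′ (suc (suc n)) (λ m → solve 3 (λ f x p → f :* (x :* p) := x :* (f :* p)) refl _ (a m) _) ⟩
    sumTo (suc (suc n)) (λ m → a m * D (powS φ m) n)
      ≈⟨ sum-shift (suc n) _ ⟩
    a 0 * D oneS n + sumTo (suc n) (λ j → a (suc j) * D (powS φ (suc j)) n)
      ≈⟨ +-cong (trans (*-congˡ (D-one n)) (zeroʳ _))
                (sum-cong′ (suc n) (λ j → trans (*-congˡ (D-pow φ j n)) (sym (*-assoc _ _ _)))) ⟩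
    0# + sumTo (suc n) (λ j → a (suc j) * fromℕ (suc j) * mulS (powS φ j) (D φ) n)
      ≈⟨ trans (+-identityˡ _) (sum-cong′ (suc n) (λ j → *-congʳ (*-comm _ _))) ⟩
    sumTo (suc n) (λ j → D a j * mulS (powS φ j) (D φ) n)
      ≈⟨ compose-mul-coeff φ φ0 (D a) (D φ) n ⟨
    mulS (compose (D a) φ) (D φ) n ∎

  ode-zero : ∀ q W → D W ≐ mulS q W → W 0 ≈ 0# → W ≐ zeroS
  ode-zero q W W′≐qW W0 n = below n n ≤-refl
    where
    below : ∀ n i → i ≤ n → W i ≈ 0#
    below zero    .zero z≤n = W0
    below (suc n) i i≤1+n with m≤n⇒m<n∨m≡n i≤1+n
    ... | inj₁ (s≤s i≤n) = below n i i≤n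
    ... | inj₂ ≡.refl    =
      trans (coeff-from-D W n) (trans (*-congˡ (trans (W′≐qW n)
        (sum-zero (suc n) (λ k _ → trans (*-congˡ (below n (n ∸ k) (m∸n≤m n k))) (zeroʳ _))))) (zeroʳ _))

  ode-unique : ∀ q Y Z → D Y ≐ mulS q Y → D Z ≐ mulS q Z → Y 0 ≈ Z 0 → Y ≐ Z
  ode-unique q Y Z Y′≐qY Z′≐qZ Y0≈Z0 n =
    trans (inverseˡ-unique _ _ (ode-zero q W W′≐qW (trans (+-congʳ Y0≈Z0) (-‿inverseʳ _)) n)) (⁻¹-involutive _)
    where
    W = addS Y (negS Z)
    W′≐qW : D W ≐ mulS q W
    W′≐qW = ≐-trans (D-add Y (negS Z))
              (≐-trans (λ n → +-cong (Y′≐qY n) (trans (D-neg Z n) (-‿cong (Z′≐qZ n))))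
                       (≐-sym (≐-trans (mulS-distribˡ q Y (negS Z)) (λ n → +-congˡ (sym (FP.-‿distribʳ-* q Z n))))))

module ElementaryFunctions {c ℓ : Level} (R : CommutativeRing c ℓ)
                           (inv : ℕ → CommutativeRing.Carrier R) (inverts : Inverts R inv) where
  open Calculus R inv inverts public

  inverse-unique : ∀ a b h → mulS a h ≐ oneS → mulS b h ≐ oneS → a ≐ b
  inverse-unique a b h ah≐1 bh≐1 = begin⟨ F.setoid ⟩
    a                  ≈⟨ mulS-oneʳ a ⟨
    mulS a oneS        ≈⟨ mulS-cong ≐-refl (≐-sym bh≐1) ⟩
    mulS a (mulS b h)  ≈⟨ fsolve 3 (λ a b h → a ⊗ (b ⊗ h) ⊜ (a ⊗ h) ⊗ b) ≐-refl a b h ⟩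
    mulS (mulS a h) b  ≈⟨ mulS-cong ah≐1 (≐-refl {b}) ⟩
    mulS oneS b        ≈⟨ mulS-oneˡ b ⟩
    b                  ∎

  geometric : FPS
  geometric n = 1#

  geometric-inverse : mulS geometric (addS oneS (negS X)) ≐ oneS
  geometric-inverse n = trans (mulS-comm geometric _ n) (trans (sum-cong′ (suc n) (λ i → *-identityʳ _)) (telescope n))
    where
    telescope : ∀ n → sumTo (suc n) (addS oneS (negS X)) ≈ oneS n
    telescope zero    = trans (+-identityˡ _) (trans (+-congˡ ε⁻¹≈ε) (+-identityʳ _))
    telescope (suc n) = begin⟨ setoid ⟩
      sumTo (suc (suc n)) (addS oneS (negS X))
        ≈⟨ trans (sum-shift (suc n) _) (+-congˡ (sum-shift n _)) ⟩
      (1# + - 0#) + ((0# + - 1#) + sumTo n (λ i → 0# + - 0#))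
        ≈⟨ +-cong (trans (+-congˡ ε⁻¹≈ε) (+-identityʳ _))
                  (+-cong (+-identityˡ _) (sum-zero n (λ i _ → trans (+-identityˡ _) ε⁻¹≈ε))) ⟩
      1# + (- 1# + 0#)
        ≈⟨ trans (+-congˡ (+-identityʳ _)) (-‿inverseʳ _) ⟩
      0# ∎

  recipOne-const : ∀ h → recipOne h 0 ≈ 1#
  recipOne-const h = +-identityˡ _

  -- 1/h = geometric(1 - h) really inverts h
  recipOne-inverse : ∀ h → h 0 ≈ 1# → mulS (recipOne h) h ≐ oneS
  recipOne-inverse h h0 = begin⟨ F.setoid ⟩
    mulS (recipOne h) h
      ≈⟨ mulS-cong (λ n → sum-cong′ (suc n) (λ m → sym (*-identityˡ _))) (≐-sym h≐1-d) ⟩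
    mulS (compose geometric d) (compose (addS oneS (negS X)) d)
      ≈⟨ compose-mul d d0 geometric _ ⟨
    compose (mulS geometric (addS oneS (negS X))) d
      ≈⟨ ≐-trans (compose-cong geometric-inverse ≐-refl) (compose-one d) ⟩
    oneS ∎
    where
    d = scale (- 1#) (dropConst h)
    d0 : d 0 ≈ 0#
    d0 = zeroʳ _
    h≐1-d : compose (addS oneS (negS X)) d ≐ h
    h≐1-d = ≐-trans (compose-add oneS (negS X) d)
             (≐-trans (λ n → +-cong (compose-one d n) (trans (compose-neg X d n) (-‿cong (compose-X d d0 n)))) coeff)
      where
      coeff : addS oneS (negS d) ≐ h
      coeff zero    = trans (+-congˡ (trans (-‿cong d0) ε⁻¹≈ε)) (trans (+-identityʳ _) (sym h0))
      coeff (suc n) = trans (+-identityˡ _) (trans (-‿cong (-1*x≈-x _)) (⁻¹-involutive _))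
        where open RingProperties ring using (-1*x≈-x)

  unit-cancel : ∀ h a → h 0 ≈ 1# → mulS h a ≐ zeroS → a ≐ zeroS
  unit-cancel h a h0 ha≐0 = begin⟨ F.setoid ⟩
    a                                ≈⟨ mulS-oneˡ a ⟨
    mulS oneS a                      ≈⟨ mulS-cong (≐-sym (recipOne-inverse h h0)) (≐-refl {a}) ⟩
    mulS (mulS (recipOne h) h) a     ≈⟨ mulS-assoc (recipOne h) h a ⟩
    mulS (recipOne h) (mulS h a)     ≈⟨ mulS-cong ≐-refl ha≐0 ⟩
    mulS (recipOne h) zeroS          ≈⟨ F.zeroʳ (recipOne h) ⟩
    zeroS                            ∎

  recipOne-compose : ∀ g φ → g 0 ≈ 1# → φ 0 ≈ 0# → recipOne (compose g φ) ≐ compose (recipOne g) φ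
  recipOne-compose g φ g0 φ0 =
    inverse-unique _ _ (compose g φ) (recipOne-inverse (compose g φ) (trans (compose-const g φ) g0))
      (≐-trans (≐-sym (compose-mul φ φ0 (recipOne g) g))
               (≐-trans (compose-cong (recipOne-inverse g g0) ≐-refl) (compose-one φ)))

  -- (1/h)′ h = -(1/h) h′, from differentiating (1/h) h = 1
  D-recipOne : ∀ h → h 0 ≈ 1# → mulS (D (recipOne h)) h ≐ negS (mulS (recipOne h) (D h))
  D-recipOne h h0 n = inverseˡ-unique _ _
    (trans (sym (D-mul (recipOne h) h n)) (trans (D-cong (recipOne-inverse h h0) n) (D-one n)))

  D-expT : D expT ≐ expT
  D-expT n = trans (sym (*-assoc _ _ _)) (trans (*-congʳ (inverts n)) (*-identityˡ _))

  expS-const : ∀ a → expS a 0 ≈ 1#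
  expS-const a = trans (+-identityˡ _) (*-identityˡ _)

  -- exp a = e^t ∘ a, so (exp a)′ = exp a · a′ by the chain rule
  D-exp : ∀ a → a 0 ≈ 0# → D (expS a) ≐ mulS (expS a) (D a)
  D-exp a a0 = ≐-trans (chain-rule a a0 expT) (mulS-cong (compose-cong D-expT (≐-refl {a})) (≐-refl {D a}))

  -- exp(y φ) = e^{yt} ∘ φ: both solve W′ = y φ′ W with W(0) = 1
  exp-compose : ∀ y φ → φ 0 ≈ 0# → expS (scale y φ) ≐ compose (expYT y) φ
  exp-compose y φ φ0 =
    ode-unique q (expS (scale y φ)) (compose E φ) left-ode right-ode
      (trans (expS-const (scale y φ)) (sym (trans (compose-const E φ) (expS-const (scale y X)))))
    where
    q = mulS (const y) (D φ)
    E = expYT y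
    left-ode : D (expS (scale y φ)) ≐ mulS q (expS (scale y φ))
    left-ode = ≐-trans (D-exp (scale y φ) (trans (*-congˡ φ0) (zeroʳ _)))
                 (≐-trans (mulS-cong ≐-refl (≐-trans (D-scale y φ) (scale-as-mul y (D φ)))) (mulS-comm _ _))
    E-ode : D E ≐ mulS E (const y)
    E-ode = ≐-trans (D-exp (scale y X) (zeroʳ _)) (mulS-cong ≐-refl (≐-trans (D-scale y X) (scale-cong y D-X)))
    right-ode : D (compose E φ) ≐ mulS q (compose E φ)
    right-ode = begin⟨ F.setoid ⟩
      D (compose E φ)
        ≈⟨ chain-rule φ φ0 E ⟩
      mulS (compose (D E) φ) (D φ)
        ≈⟨ mulS-congˡ (D φ) (≐-trans (compose-cong E-ode ≐-refl) (compose-mul φ φ0 E (const y))) ⟩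
      mulS (mulS (compose E φ) (compose (const y) φ)) (D φ)
        ≈⟨ mulS-congˡ (D φ) (mulS-congʳ (compose E φ) (≐-trans (compose-scale y oneS φ) (scale-cong y (compose-one φ)))) ⟩
      mulS (mulS (compose E φ) (const y)) (D φ)
        ≈⟨ fsolve 3 (λ w c d → (w ⊗ c) ⊗ d ⊜ (c ⊗ d) ⊗ w) ≐-refl (compose E φ) (const y) (D φ) ⟩
      mulS q (compose E φ) ∎

  log1pX-coeff : ∀ m → log1p X (suc m) ≈ sgn m * inv m
  log1pX-coeff m =
    trans (sum-last m _ (λ k k<m → trans (*-congˡ (trans (*-congˡ (earlier k k<m)) (zeroʳ _))) (zeroʳ _)))
          (*-congˡ (trans (*-congˡ diagonal) (*-identityʳ _)))
    where
    diagonal : powS X (suc m) (suc m) ≈ 1#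
    diagonal = trans (reflexive (≡.cong (powS X (suc m)) (≡.sym (+ℕ-identityʳ (suc m))))) (powX-coeff (suc m) 0)
    earlier : ∀ k → k < m → powS X (suc k) (suc m) ≈ 0#
    earlier k k<m =
      trans (reflexive (≡.cong (powS X (suc k)) (≡.sym (≡.cong suc (m+[n∸m]≡n (<⇒≤ k<m))))))
            (trans (powX-coeff (suc k) (m ∸ k)) (oneS-pos _ (m<n⇒0<n∸m k<m)))

  log1p-compose : ∀ a → log1p a ≐ compose (log1p X) a
  log1p-compose a n =
    sym (trans (sum-shift n _) (trans (trans (+-congʳ (zeroˡ _)) (+-identityˡ _))
          (sum-cong′ n (λ k → trans (*-congʳ (log1pX-coeff k)) (*-assoc _ _ _)))))

  D-log1pX : mulS (D (log1p X)) (addS oneS X) ≐ oneS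
  D-log1pX n = trans (mulS-comm _ _ n) (trans (mulS-distribʳ (D (log1p X)) oneS X n)
                 (trans (+-congʳ (mulS-oneˡ (D (log1p X)) n)) (alternating n)))
    where
    D-coeff : ∀ n → D (log1p X) n ≈ sgn n
    D-coeff n = trans (*-congˡ (log1pX-coeff n))
                  (trans (solve 3 (λ f s i → f :* (s :* i) := s :* (f :* i)) refl (fromℕ (suc n)) (sgn n) (inv n))
                         (trans (*-congˡ (inverts n)) (*-identityʳ _)))
    alternating : ∀ n → D (log1p X) n + mulS X (D (log1p X)) n ≈ oneS n
    alternating zero    = trans (+-cong (D-coeff 0) (mulX-zero (D (log1p X)))) (+-identityʳ _)
    alternating (suc n) = trans (+-cong (D-coeff (suc n)) (trans (mulX-suc (D (log1p X)) n) (D-coeff n))) (-‿inverseˡ _)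

  logS : FPS → FPS
  logS h = log1p (dropConst h)

  D-log : ∀ h → h 0 ≈ 1# → mulS (D (logS h)) h ≐ D h
  D-log h h0 = begin⟨ F.setoid ⟩
    mulS (D (logS h)) h
      ≈⟨ mulS-cong (≐-trans (D-cong (log1p-compose d)) (chain-rule d refl (log1p X))) (≐-sym h≐1+d) ⟩
    mulS (mulS (compose (D (log1p X)) d) (D d)) (compose (addS oneS X) d)
      ≈⟨ fsolve 3 (λ a b c → (a ⊗ b) ⊗ c ⊜ (a ⊗ c) ⊗ b) ≐-refl (compose (D (log1p X)) d) (D d) (compose (addS oneS X) d) ⟩
    mulS (mulS (compose (D (log1p X)) d) (compose (addS oneS X) d)) (D d)
      ≈⟨ mulS-congˡ (D d) (≐-sym (compose-mul d refl (D (log1p X)) (addS oneS X))) ⟩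
    mulS (compose (mulS (D (log1p X)) (addS oneS X)) d) (D d)
      ≈⟨ mulS-congˡ (D d) (≐-trans (compose-cong D-log1pX ≐-refl) (compose-one d)) ⟩
    mulS oneS (D d)
      ≈⟨ mulS-oneˡ _ ⟩
    D h ∎
    where
    d = dropConst h
    h≐1+d : compose (addS oneS X) d ≐ h
    h≐1+d = ≐-trans (compose-add oneS X d) (≐-trans (λ n → +-cong (compose-one d n) (compose-X d refl n)) coeff)
      where
      coeff : addS oneS d ≐ h
      coeff zero    = trans (+-identityʳ _) (sym h0)
      coeff (suc n) = +-identityˡ _

  -- Y solves  h Y′ = β h′ Y,  the differential equation characterising Y = h^β
  SolvesPowerODE : Carrier → FPS → FPS → Set ℓ
  SolvesPowerODE β h Y = mulS h (D Y) ≐ mulS (const β) (mulS (D h) Y)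

  -- h^β has constant term 1, and solves the power equation since
  -- (h^β)′ = h^β · β (log h)′ and (log h)′ h = h′
  cpow-const : ∀ β h → cpow β h 0 ≈ 1#
  cpow-const β h = expS-const (scale β (logS h))

  cpow-ode : ∀ β h → h 0 ≈ 1# → SolvesPowerODE β h (cpow β h)
  cpow-ode β h h0 = begin⟨ F.setoid ⟩
    mulS h (D Y)
      ≈⟨ mulS-cong ≐-refl (≐-trans (D-exp (scale β (logS h)) (zeroʳ _))
                                    (mulS-cong ≐-refl (≐-trans (D-scale β (logS h)) (scale-as-mul β _)))) ⟩
    mulS h (mulS Y (mulS (const β) (D (logS h))))
      ≈⟨ fsolve 4 (λ h y c l → h ⊗ (y ⊗ (c ⊗ l)) ⊜ c ⊗ ((l ⊗ h) ⊗ y)) ≐-refl h Y (const β) (D (logS h)) ⟩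
    mulS (const β) (mulS (mulS (D (logS h)) h) Y)
      ≈⟨ mulS-congʳ (const β) (mulS-congˡ Y (D-log h h0)) ⟩
    mulS (const β) (mulS (D h) Y) ∎
    where
    Y = cpow β h

  -- the power equation is a linear equation Y′ = q Y, so its solutions are
  -- determined by their constant terms
  power-ode-unique : ∀ β h → h 0 ≈ 1# → ∀ Y Z → SolvesPowerODE β h Y → SolvesPowerODE β h Z →
                     Y 0 ≈ Z 0 → Y ≐ Z
  power-ode-unique β h h0 Y Z Y-ode Z-ode = ode-unique q Y Z (linear Y Y-ode) (linear Z Z-ode)
    where
    q = mulS (const β) (mulS (recipOne h) (D h))
    linear : ∀ W → SolvesPowerODE β h W → D W ≐ mulS q W
    linear W W-ode = begin⟨ F.setoid ⟩
      D W                                      ≈⟨ mulS-oneˡ (D W) ⟨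
      mulS oneS (D W)                          ≈⟨ mulS-congˡ (D W) (≐-sym (recipOne-inverse h h0)) ⟩
      mulS (mulS (recipOne h) h) (D W)         ≈⟨ mulS-assoc (recipOne h) h (D W) ⟩
      mulS (recipOne h) (mulS h (D W))         ≈⟨ mulS-cong ≐-refl W-ode ⟩
      mulS (recipOne h) (mulS (const β) (mulS (D h) W))
        ≈⟨ fsolve 4 (λ r c d w → r ⊗ (c ⊗ (d ⊗ w)) ⊜ (c ⊗ (r ⊗ d)) ⊗ w) ≐-refl (recipOne h) (const β) (D h) W ⟩
      mulS q W                                 ∎

  cpow-nat : ∀ h → h 0 ≈ 1# → ∀ m → cpow (fromℕ m) h ≐ powS h m
  cpow-nat h h0 m = power-ode-unique (fromℕ m) h h0 (cpow (fromℕ m) h) (powS h m)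
    (cpow-ode (fromℕ m) h h0) (powS-ode m) (trans (cpow-const (fromℕ m) h) (sym (powS-const h m h0)))
    where
    powS-ode : ∀ m → SolvesPowerODE (fromℕ m) h (powS h m)
    powS-ode zero    = ≐-trans (mulS-congʳ h D-one)
                         (≐-trans (F.zeroʳ h) (≐-sym (≐-trans (mulS-congˡ (mulS (D h) oneS) (λ i → zeroˡ (oneS i)))
                                                              (F.zeroˡ (mulS (D h) oneS)))))
    powS-ode (suc k) = begin⟨ F.setoid ⟩
      mulS h (D (powS h (suc k)))
        ≈⟨ mulS-cong ≐-refl (≐-trans (D-pow h k) (scale-as-mul (fromℕ (suc k)) _)) ⟩
      mulS h (mulS (const (fromℕ (suc k))) (mulS (powS h k) (D h)))
        ≈⟨ fsolve 4 (λ h c p d → h ⊗ (c ⊗ (p ⊗ d)) ⊜ c ⊗ (d ⊗ (h ⊗ p))) ≐-refl h (const (fromℕ (suc k))) (powS h k) (D h) ⟩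
      mulS (const (fromℕ (suc k))) (mulS (D h) (powS h (suc k))) ∎

  power-ode-recipOne : ∀ β h → h 0 ≈ 1# → ∀ Z → SolvesPowerODE β (recipOne h) Z →
                       SolvesPowerODE (- β) h Z
  power-ode-recipOne β h h0 Z Z-ode = begin⟨ F.setoid ⟩
    mulS h (D Z)
      ≈⟨ mulS-oneʳ _ ⟨
    mulS (mulS h (D Z)) oneS
      ≈⟨ mulS-cong ≐-refl (≐-sym (recipOne-inverse h h0)) ⟩
    mulS (mulS h (D Z)) (mulS rh h)
      ≈⟨ fsolve 3 (λ h dz r → (h ⊗ dz) ⊗ (r ⊗ h) ⊜ (h ⊗ h) ⊗ (r ⊗ dz)) ≐-refl h (D Z) rh ⟩
    mulS (mulS h h) (mulS rh (D Z))
      ≈⟨ mulS-cong ≐-refl Z-ode ⟩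
    mulS (mulS h h) (mulS (const β) (mulS (D rh) Z))
      ≈⟨ fsolve 5 (λ h c dr z dh → (h ⊗ h) ⊗ (c ⊗ (dr ⊗ z)) ⊜ (c ⊗ (z ⊗ h)) ⊗ (dr ⊗ h)) ≐-refl h (const β) (D rh) Z (D h) ⟩
    mulS (mulS (const β) (mulS Z h)) (mulS (D rh) h)
      ≈⟨ mulS-cong ≐-refl (D-recipOne h h0) ⟩
    mulS (mulS (const β) (mulS Z h)) (negS (mulS rh (D h)))
      ≈⟨ FP.-‿distribʳ-* (mulS (const β) (mulS Z h)) (mulS rh (D h)) ⟨
    negS (mulS (mulS (const β) (mulS Z h)) (mulS rh (D h)))
      ≈⟨ F.-‿cong (fsolve 5 (λ c z h r dh → (c ⊗ (z ⊗ h)) ⊗ (r ⊗ dh) ⊜ (c ⊗ (dh ⊗ z)) ⊗ (r ⊗ h)) ≐-refl (const β) Z h rh (D h)) ⟩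
    negS (mulS (mulS (const β) (mulS (D h) Z)) (mulS rh h))
      ≈⟨ F.-‿cong (≐-trans (mulS-cong ≐-refl (recipOne-inverse h h0)) (mulS-oneʳ _)) ⟩
    negS (mulS (const β) (mulS (D h) Z))
      ≈⟨ FP.-‿distribˡ-* (const β) (mulS (D h) Z) ⟩
    mulS (negS (const β)) (mulS (D h) Z)
      ≈⟨ mulS-congˡ (mulS (D h) Z) (λ n → -‿distribˡ-* β (oneS n)) ⟩
    mulS (const (- β)) (mulS (D h) Z) ∎
    where
    rh = recipOne h
    open RingProperties ring using (-‿distribˡ-*)

  power-ode-product : ∀ β h → h 0 ≈ 1# → ∀ Y Z → SolvesPowerODE β h Y → SolvesPowerODE (- β) h Z →
                      D (mulS Y Z) ≐ zeroS
  power-ode-product β h h0 Y Z Y-ode Z-ode = unit-cancel h (D (mulS Y Z)) h0 (begin⟨ F.setoid ⟩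
    mulS h (D (mulS Y Z))
      ≈⟨ mulS-cong ≐-refl (D-mul Y Z) ⟩
    mulS h (addS (mulS (D Y) Z) (mulS Y (D Z)))
      ≈⟨ fsolve 5 (λ h dy z y dz → h ⊗ ((dy ⊗ z) ⊕ (y ⊗ dz)) ⊜ ((h ⊗ dy) ⊗ z) ⊕ (y ⊗ (h ⊗ dz))) ≐-refl h (D Y) Z Y (D Z) ⟩
    addS (mulS (mulS h (D Y)) Z) (mulS Y (mulS h (D Z)))
      ≈⟨ F.+-cong (mulS-congˡ Z Y-ode) (mulS-congʳ Y Z-ode) ⟩
    addS (mulS (mulS (const β) (mulS (D h) Y)) Z) (mulS Y (mulS (const (- β)) (mulS (D h) Z)))
      ≈⟨ fsolve 5 (λ b b′ d y z → ((b ⊗ (d ⊗ y)) ⊗ z) ⊕ (y ⊗ (b′ ⊗ (d ⊗ z))) ⊜ (b ⊕ b′) ⊗ (d ⊗ (y ⊗ z)))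
                  ≐-refl (const β) (const (- β)) (D h) Y Z ⟩
    mulS (addS (const β) (const (- β))) (mulS (D h) (mulS Y Z))
      ≈⟨ mulS-congˡ (mulS (D h) (mulS Y Z)) (λ n → trans (sym (distribʳ (oneS n) β (- β))) (trans (*-congʳ (-‿inverseʳ β)) (zeroˡ _))) ⟩
    mulS zeroS (mulS (D h) (mulS Y Z))
      ≈⟨ F.zeroˡ (mulS (D h) (mulS Y Z)) ⟩
    zeroS ∎)

  cpow-recipOne : ∀ α h → h 0 ≈ 1# → mulS (cpow α h) (cpow α (recipOne h)) ≐ oneS
  cpow-recipOne α h h0 =
    ode-unique zeroS (mulS (cpow α h) (cpow α (recipOne h))) oneS
      (≐-trans (power-ode-product α h h0 (cpow α h) (cpow α (recipOne h)) (cpow-ode α h h0)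
                 (power-ode-recipOne α h h0 (cpow α (recipOne h)) (cpow-ode α (recipOne h) (recipOne-const h))))
               (≐-sym (F.zeroˡ (mulS (cpow α h) (cpow α (recipOne h))))))
      (≐-trans D-one (≐-sym (F.zeroˡ oneS)))
      (trans (+-identityˡ _) (trans (*-cong (cpow-const α h) (cpow-const α (recipOne h))) (*-identityˡ _)))

  recipOne-cpow : ∀ α h → h 0 ≈ 1# → recipOne (cpow α h) ≐ cpow α (recipOne h)
  recipOne-cpow α h h0 = inverse-unique _ _ (cpow α h) (recipOne-inverse (cpow α h) (cpow-const α h))
    (≐-trans (mulS-comm _ _) (cpow-recipOne α h h0))

module LagrangeInversion {c ℓ : Level} (R : CommutativeRing c ℓ)
                         (inv : ℕ → CommutativeRing.Carrier R) (inverts : Inverts R inv) where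
  open ElementaryFunctions R inv inverts public

  module _ (g ρ : FPS) (g0 : g 0 ≈ 0#) (gρ≐t : mulS g ρ ≐ X) where

    -- g′ ρ + g ρ′ = 1, the derivative of g ρ = t
    leibniz-gρ : addS (mulS (D g) ρ) (mulS g (D ρ)) ≐ oneS
    leibniz-gρ = ≐-trans (≐-sym (D-mul g ρ)) (≐-trans (D-cong gρ≐t) D-X)

    residue : ∀ k → mulS (D g) (powS ρ (suc k)) k ≈ oneS k
    residue zero = begin⟨ setoid ⟩
      mulS (D g) (mulS ρ oneS) 0           ≈⟨ mulS-congʳ (D g) (mulS-oneʳ ρ) 0 ⟩
      mulS (D g) ρ 0                       ≈⟨ +-identityʳ _ ⟨
      mulS (D g) ρ 0 + 0#                  ≈⟨ +-congˡ (trans (+-identityˡ _) (trans (*-congʳ g0) (zeroˡ _))) ⟨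
      mulS (D g) ρ 0 + mulS g (D ρ) 0      ≈⟨ leibniz-gρ 0 ⟩
      1#                                   ∎
    residue (suc k) = begin⟨ setoid ⟩
      mulS (D g) (mulS ρ Pk) (suc k)
        ≈⟨ mulS-assoc (D g) ρ Pk (suc k) ⟨
      mulS (mulS (D g) ρ) Pk (suc k)
        ≈⟨ mulS-congˡ Pk g′ρ≐1-gρ′ (suc k) ⟩
      mulS (addS oneS (negS (mulS g (D ρ)))) Pk (suc k)
        ≈⟨ mulS-distribʳ Pk oneS _ (suc k) ⟩
      mulS oneS Pk (suc k) + mulS (negS (mulS g (D ρ))) Pk (suc k)
        ≈⟨ +-cong (mulS-oneˡ Pk (suc k)) (sym (FP.-‿distribˡ-* (mulS g (D ρ)) Pk (suc k))) ⟩
      Pk (suc k) + - mulS (mulS g (D ρ)) Pk (suc k)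
        ≈⟨ +-congˡ (-‿cong gρ′Pk) ⟩
      Pk (suc k) + - Pk (suc k)
        ≈⟨ -‿inverseʳ _ ⟩
      0# ∎
      where
      Pk = powS ρ (suc k)
      g′ρ≐1-gρ′ : mulS (D g) ρ ≐ addS oneS (negS (mulS g (D ρ)))
      g′ρ≐1-gρ′ n = trans (sym (+-identityʳ _)) (trans (+-congˡ (sym (-‿inverseʳ _)))
                      (trans (sym (+-assoc _ _ _)) (+-congʳ (leibniz-gρ n))))
      -- [t^(k+1)] g ρ′ ρ^(k+1) = [t^k] ρ^k ρ′ = [t^(k+1)] ρ^(k+1)
      gρ′Pk : mulS (mulS g (D ρ)) Pk (suc k) ≈ Pk (suc k)
      gρ′Pk = begin⟨ setoid ⟩
        mulS (mulS g (D ρ)) (mulS ρ (powS ρ k)) (suc k)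
          ≈⟨ fsolve 4 (λ g d r p → (g ⊗ d) ⊗ (r ⊗ p) ⊜ (g ⊗ r) ⊗ (p ⊗ d)) ≐-refl g (D ρ) ρ (powS ρ k) (suc k) ⟩
        mulS (mulS g ρ) (mulS (powS ρ k) (D ρ)) (suc k)
          ≈⟨ mulS-congˡ (mulS (powS ρ k) (D ρ)) gρ≐t (suc k) ⟩
        mulS X (mulS (powS ρ k) (D ρ)) (suc k)
          ≈⟨ mulX-suc (mulS (powS ρ k) (D ρ)) k ⟩
        mulS (powS ρ k) (D ρ) k
          ≈⟨ inv-cancel k _ ⟨
        inv k * (fromℕ (suc k) * mulS (powS ρ k) (D ρ) k)
          ≈⟨ *-congˡ (D-pow ρ k k) ⟨
        inv k * D Pk k
          ≈⟨ coeff-from-D Pk k ⟨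
        Pk (suc k) ∎

    -- [t^m] B(g) · g′ ρ^(m+1) = [t^m] B: only the power g^m contributes
    extract-coeff : ∀ B m → mulS (compose B g) (mulS (D g) (powS ρ (suc m))) m ≈ B m
    extract-coeff B m = begin⟨ setoid ⟩
      mulS (compose B g) Cm m
        ≈⟨ compose-mul-coeff g g0 B Cm m ⟩
      sumTo (suc m) (λ j → B j * mulS (powS g j) Cm m)
        ≈⟨ sum-cong (suc m) (λ j j<1+m → *-congˡ (power-term j (<-suc⇒≤ j<1+m))) ⟩
      sumTo (suc m) (λ j → B j * oneS (m ∸ j))
        ≈⟨ sum-last m _ (λ j j<m → trans (*-congˡ (oneS-pos _ (m<n⇒0<n∸m j<m))) (zeroʳ _)) ⟩
      B m * oneS (m ∸ m)
        ≈⟨ trans (*-congˡ (reflexive (≡.cong oneS (n∸n≡0 m)))) (*-identityʳ _) ⟩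
      B m ∎
      where
      Cm = mulS (D g) (powS ρ (suc m))
      -- g^j g′ ρ^(m+1) = t^j g′ ρ^(m-j+1), whose m-th coefficient is a residue
      power-term : ∀ j → j ≤ m → mulS (powS g j) Cm m ≈ oneS (m ∸ j)
      power-term j j≤m = begin⟨ setoid ⟩
        mulS (powS g j) Cm m
          ≈⟨ mulS-congʳ (powS g j) (mulS-congʳ (D g) (≐-trans (λ n → reflexive (≡.cong (λ z → powS ρ z n) split))
                                                              (powS-+ ρ j (suc r)))) m ⟩
        mulS (powS g j) (mulS (D g) (mulS (powS ρ j) (powS ρ (suc r)))) m
          ≈⟨ fsolve 4 (λ a d b c → a ⊗ (d ⊗ (b ⊗ c)) ⊜ (a ⊗ b) ⊗ (d ⊗ c)) ≐-refl (powS g j) (D g) (powS ρ j) (powS ρ (suc r)) m ⟩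
        mulS (mulS (powS g j) (powS ρ j)) (mulS (D g) (powS ρ (suc r))) m
          ≈⟨ mulS-congˡ (mulS (D g) (powS ρ (suc r))) (≐-trans (≐-sym (powS-mul g ρ j)) (powS-cong j gρ≐t)) m ⟩
        mulS (powS X j) (mulS (D g) (powS ρ (suc r))) m
          ≈⟨ reflexive (≡.cong (mulS (powS X j) (mulS (D g) (powS ρ (suc r)))) (≡.sym (m+[n∸m]≡n j≤m))) ⟩
        mulS (powS X j) (mulS (D g) (powS ρ (suc r))) (j +ℕ r)
          ≈⟨ powX-shift j r (mulS (D g) (powS ρ (suc r))) ⟩
        mulS (D g) (powS ρ (suc r)) r
          ≈⟨ residue r ⟩
        oneS r ∎
        where
        r = m ∸ j
        split : suc m ≡ j +ℕ suc r
        split = ≡.trans (≡.cong suc (≡.sym (m+[n∸m]≡n j≤m))) (≡.sym (+-suc j r))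

  lagrange-inversion : ∀ φ fbar → φ 0 ≈ 1# → fbar 0 ≈ 0# →
    compose (mulS X (recipOne φ)) fbar ≐ X →
    ∀ A m → compose A fbar (suc m) ≈ inv m * mulS (D A) (powS φ (suc m)) m
  lagrange-inversion φ fbar φ0 fbar0 f∘fbar≐t A m =
    trans (coeff-from-D (compose A fbar) m) (*-congˡ (begin⟨ setoid ⟩
      D (compose A fbar) m
        ≈⟨ chain-rule fbar fbar0 A m ⟩
      mulS (compose (D A) fbar) (D fbar) m
        ≈⟨ insert-φ^n m ⟨
      mulS (compose B fbar) (mulS (D fbar) (powS ρ (suc m))) m
        ≈⟨ extract-coeff fbar ρ fbar0 fbar·ρ≐t B m ⟩
      B m ∎))
    where
    ρ = compose (recipOne φ) fbar
    B = mulS (D A) (powS φ (suc m))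
    fbar·ρ≐t : mulS fbar ρ ≐ X
    fbar·ρ≐t = ≐-trans (mulS-congˡ ρ (≐-sym (compose-X fbar fbar0)))
                        (≐-trans (≐-sym (compose-mul fbar fbar0 X (recipOne φ))) f∘fbar≐t)
    -- φ(f̄) ρ = 1, so the factor φ(f̄)^(m+1) ρ^(m+1) may be inserted
    φ∘fbar·ρ≐1 : mulS (compose φ fbar) ρ ≐ oneS
    φ∘fbar·ρ≐1 = ≐-trans (≐-sym (compose-mul fbar fbar0 φ (recipOne φ)))
                   (≐-trans (compose-cong (≐-trans (mulS-comm φ (recipOne φ)) (recipOne-inverse φ φ0)) ≐-refl)
                            (compose-one fbar))
    insert-φ^n : mulS (compose B fbar) (mulS (D fbar) (powS ρ (suc m))) ≐ mulS (compose (D A) fbar) (D fbar)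
    insert-φ^n = begin⟨ F.setoid ⟩
      mulS (compose B fbar) (mulS (D fbar) (powS ρ (suc m)))
        ≈⟨ mulS-congˡ (mulS (D fbar) (powS ρ (suc m)))
             (≐-trans (compose-mul fbar fbar0 (D A) (powS φ (suc m)))
                      (mulS-congʳ (compose (D A) fbar) (compose-pow fbar fbar0 φ (suc m)))) ⟩
      mulS (mulS A′ (powS (compose φ fbar) (suc m))) (mulS (D fbar) (powS ρ (suc m)))
        ≈⟨ fsolve 4 (λ a p d q → (a ⊗ p) ⊗ (d ⊗ q) ⊜ (a ⊗ d) ⊗ (p ⊗ q)) ≐-refl
                    A′ (powS (compose φ fbar) (suc m)) (D fbar) (powS ρ (suc m)) ⟩
      mulS (mulS A′ (D fbar)) (mulS (powS (compose φ fbar) (suc m)) (powS ρ (suc m)))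
        ≈⟨ mulS-congʳ (mulS A′ (D fbar))
             (≐-trans (≐-sym (powS-mul (compose φ fbar) ρ (suc m)))
                      (≐-trans (powS-cong (suc m) φ∘fbar·ρ≐1) (powS-one (suc m)))) ⟩
      mulS (mulS A′ (D fbar)) oneS
        ≈⟨ mulS-oneʳ _ ⟩
      mulS A′ (D fbar) ∎
      where A′ = compose (D A) fbar

  egf-convolution : ∀ A B m →
    fromℕ (m !) * mulS A (D B) m ≈ sumTo (suc m) (λ l → fromℕ (m C l) * (egfCoeff A l * egfCoeff B (suc m ∸ l)))
  egf-convolution A B m =
    trans (sum-*ˡ (suc m) _ _) (sum-cong (suc m) (λ l l<1+m → term l (<-suc⇒≤ l<1+m)))
    where
    term : ∀ l → l ≤ m → fromℕ (m !) * (A l * D B (m ∸ l))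
                         ≈ fromℕ (m C l) * (egfCoeff A l * egfCoeff B (suc m ∸ l))
    term l l≤m rewrite +-∸-assoc 1 l≤m = begin⟨ setoid ⟩
      fromℕ (m !) * (A l * (fromℕ (suc r) * B (suc r)))
        ≈⟨ *-congʳ (trans (reflexive (≡.cong fromℕ (≡.sym (choose-factorials l≤m))))
                          (trans (fromℕ-* (m C l) _) (*-congˡ (fromℕ-* (l !) (r !))))) ⟩
      fromℕ (m C l) * (fromℕ (l !) * fromℕ (r !)) * (A l * (fromℕ (suc r) * B (suc r)))
        ≈⟨ solve 6 (λ c a b x s y → c :* (a :* b) :* (x :* (s :* y)) := c :* ((a :* x) :* ((s :* b) :* y))) refl
                   (fromℕ (m C l)) (fromℕ (l !)) (fromℕ (r !)) (A l) (fromℕ (suc r)) (B (suc r)) ⟩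
      fromℕ (m C l) * (egfCoeff A l * ((fromℕ (suc r) * fromℕ (r !)) * B (suc r)))
        ≈⟨ *-congˡ (*-congˡ (*-congʳ (sym (fromℕ-* (suc r) (r !))))) ⟩
      fromℕ (m C l) * (egfCoeff A l * egfCoeff B (suc r)) ∎
      where r = m ∸ l

module EulerNarumiSeries {c ℓ : Level} (R : CommutativeRing c ℓ)
                         (inv : ℕ → CommutativeRing.Carrier R) (inverts : Inverts R inv) where
  open LagrangeInversion R inv inverts public

  eulerSeries : Carrier → Carrier → FPS
  eulerSeries α y = mulS (cpow α (recipOne halfExpPlusOne)) (expYT y)

  halfExpPlusOne-const : halfExpPlusOne 0 ≈ 1#
  halfExpPlusOne-const = trans (*-congˡ (+-congˡ (sym (+-identityʳ 1#)))) (trans (*-comm _ _) (inverts 1))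

  logOverT-const : logOverT 0 ≈ 1#
  logOverT-const = trans (log1pX-coeff 0) (trans (*-identityˡ _) inv-0)
    where
    inv-0 : inv 0 ≈ 1#
    inv-0 = trans (sym (*-identityˡ _)) (trans (*-congʳ (sym (+-identityʳ 1#))) (inverts 0))

  factorial-inv : ∀ m a → fromℕ (suc m !) * (inv m * a) ≈ fromℕ (m !) * a
  factorial-inv m a = begin⟨ setoid ⟩
    fromℕ (suc m !) * (inv m * a)
      ≈⟨ *-congʳ (fromℕ-* (suc m) (m !)) ⟩
    fromℕ (suc m) * fromℕ (m !) * (inv m * a)
      ≈⟨ solve 4 (λ s f i a → s :* f :* (i :* a) := (s :* i) :* (f :* a)) refl (fromℕ (suc m)) (fromℕ (m !)) (inv m) a ⟩
    fromℕ (suc m) * inv m * (fromℕ (m !) * a)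
      ≈⟨ trans (*-congʳ (inverts m)) (*-identityˡ _) ⟩
    fromℕ (m !) * a ∎

  -- the Narumi numbers N_l^(n) are the exponential coefficients of φ^n,
  -- since (1+t)^0 = 1
  narumi-powS : ∀ n l → narumiNum (fromℕ n) l ≈ egfCoeff (powS logOverT n) l
  narumi-powS n l = *-congˡ (trans (mulS-cong (cpow-nat logOverT logOverT-const n)
                                              (cpow-nat (addS oneS X) (+-identityʳ 1#) 0) l)
                                   (mulS-oneʳ (powS logOverT n) l))

  sheffer-as-composition : ∀ α y fbar → fbar 0 ≈ 0# →
    mulS (recipOne (compose (gEuler α) fbar)) (expS (scale y fbar)) ≐ compose (eulerSeries α y) fbar
  sheffer-as-composition α y fbar fbar0 = begin⟨ F.setoid ⟩
    mulS (recipOne (compose (gEuler α) fbar)) (expS (scale y fbar))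
      ≈⟨ mulS-cong (recipOne-compose (gEuler α) fbar (cpow-const α halfExpPlusOne) fbar0) (exp-compose y fbar fbar0) ⟩
    mulS (compose (recipOne (gEuler α)) fbar) (compose (expYT y) fbar)
      ≈⟨ compose-mul fbar fbar0 (recipOne (gEuler α)) (expYT y) ⟨
    compose (mulS (recipOne (gEuler α)) (expYT y)) fbar
      ≈⟨ compose-cong (mulS-congˡ (expYT y) (recipOne-cpow α halfExpPlusOne halfExpPlusOne-const)) ≐-refl ⟩
    compose (eulerSeries α y) fbar ∎

-- S_n(x) = ∑_{l<n} (n-1 choose l) N_l^(n) E_{n-l}^(α)(x) for n ≥ 1.
-- By Lagrange inversion S_{m+1}(x) = (m+1)! [t^(m+1)] E(f̄) = m! [t^m] E′ φ^(m+1),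
-- which the binomial convolution splits into Narumi numbers and Euler polynomials.
theorem4 : {c ℓ : Level} (R : CommutativeRing c ℓ)
  (inv : ℕ → CommutativeRing.Carrier R) →
  let open CommutativeRing R
      open PS R inv
  in (∀ k → fromℕ (suc k) * inv k ≈ 1#) →
     (α x : Carrier) (fbar : FPS) →
     fbar 0 ≈ 0# →
     (∀ k → compose fNar fbar k ≈ X k) →
     (n : ℕ) → 1 ≤ n →
     shefferVal (gEuler α) fbar x n
       ≈ sumTo n (λ l → fromℕ ((n ∸ 1) C l)
                         * (narumiNum (fromℕ n) l * eulerPoly α x (n ∸ l)))
theorem4 R inv inverts α x fbar fbar0 f∘fbar≐t zero    ()
theorem4 R inv inverts α x fbar fbar0 f∘fbar≐t (suc m) _ = begin⟨ setoid ⟩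
  fromℕ (suc m !) * mulS (recipOne (compose (gEuler α) fbar)) (expS (scale x fbar)) (suc m)
    ≈⟨ *-congˡ (sheffer-as-composition α x fbar fbar0 (suc m)) ⟩
  fromℕ (suc m !) * compose E fbar (suc m)
    ≈⟨ *-congˡ (lagrange-inversion logOverT fbar logOverT-const fbar0 f∘fbar≐t E m) ⟩
  fromℕ (suc m !) * (inv m * mulS (D E) (powS logOverT (suc m)) m)
    ≈⟨ trans (factorial-inv m _) (*-congˡ (mulS-comm (D E) _ m)) ⟩
  fromℕ (m !) * mulS (powS logOverT (suc m)) (D E) m
    ≈⟨ egf-convolution (powS logOverT (suc m)) E m ⟩
  sumTo (suc m) (λ l → fromℕ (m C l) * (egfCoeff (powS logOverT (suc m)) l * egfCoeff E (suc m ∸ l)))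
    ≈⟨ sum-cong′ (suc m) (λ l → *-congˡ (*-congʳ (sym (narumi-powS (suc m) l)))) ⟩
  sumTo (suc m) (λ l → fromℕ (m C l) * (narumiNum (fromℕ (suc m)) l * eulerPoly α x (suc m ∸ l))) ∎
  where
  open EulerNarumiSeries R inv inverts
  E = eulerSeries α x
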